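{- Let $\mathfrak L$ and $\mathfrak L'$ be languages with value domains $\mathbb V$ and $\mathbb V'$, and let $\sim$ and $\approx$ be equivalence relations on a class $\mathbb Z\supseteq\mathbb V\cup\mathbb V'$. Suppose there exists a translation from $\mathfrak L$ into $\mathfrak L'$ that is correct up to $\sim$, and that $\approx$ is a congruence for $\mathfrak L'$ which is coarser than $\sim$ (i.e. $p\sim q$ implies $p\approx q$). Then $\approx$ is a congruence for $\mathfrak L$.
   Context: Fix a set $\mathcal V$ of variables. A language $\mathfrak L$ consists of a set $\mathbb T_{\mathfrak L}$ of expressions built from variables in $\mathcal V$ by means of operators (and possibly recursion constructs), a domain of values $\mathbb V$, and a semantic mapping $[\![\cdot]\!]_{\mathfrak L}:\mathbb T_{\mathfrak L}\to((\mathcal V\to\mathbb V)\to\mathbb V)$; a function $\rho:\mathcal V\to\mathbb V$ is a valuation. For an equivalence $R$ on $\mathbb Z$, valuations $\eta,\rho:\mathcal V\to\mathbb Z$ satisfy $\eta\,R\,\rho$ if $\eta(X)\,R\,\rho(X)$ for all $X\in\mathcal V$. A translation $\mathcal T:\mathbb T_{\mathfrak L}\to\mathbb T_{\mathfrak L'}$ is correct up to $R$ if (i) for every $v\in\mathbb V$ there is $v'\in\mathbb V'$ with $v'\,R\,v$, and (ii) $[\![\mathcal T(E)]\!]_{\mathfrak L'}(\eta)\,R\,[\![E]\!]_{\mathfrak L}(\rho)$ for all $E\in\mathbb T_{\mathfrak L}$ and all valuations $\eta:\mathcal V\to\mathbb V'$, $\rho:\mathcal V\to\mathbb V$ with $\eta\,R\,\rho$.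 $R$ is a congruence for a language $\mathfrak K$ with value domain $\mathbb W$ if $[\![E]\!]_{\mathfrak K}(\nu)\,R\,[\![E]\!]_{\mathfrak K}(\rho)$ for every expression $E$ of $\mathfrak K$ and all valuations $\nu,\rho:\mathcal V\to\mathbb W$ with $\nu\,R\,\rho$. -}

module Defs where

open import Level using (Level; _⊔_; suc)
open import Data.Product using (Σ; ∃; _×_; proj₁)
open import Relation.Binary.Core using (Rel)
open import Relation.Binary.Structures using (IsEquivalence)

record Language {v z : Level} (Var : Set v) (Z : Set z) (t d : Level)
       : Set (v ⊔ z ⊔ Level.suc t ⊔ Level.suc d) where
  field
    Expr : Set t
    Dom  : Z → Set d
  Value : Set (z ⊔ d)
  Value = Σ Z Dom
  Valuation : Set (v ⊔ z ⊔ d)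
  Valuation = Var → Value
  field
    ⟦_⟧ : Expr → Valuation → Value

open Language public

module _ {v z r : Level} {Var : Set v} {Z : Set z} where

  _on-valuations_ : ∀ {d d'} {D : Z → Set d} {D' : Z → Set d'} →
                    Rel Z r → (Var → Σ Z D) → (Var → Σ Z D') → Set (v ⊔ r)
  (R on-valuations η) ρ = ∀ X → R (proj₁ (η X)) (proj₁ (ρ X))

  CorrectUpTo : ∀ {t d t' d'} (L : Language Var Z t d) (L' : Language Var Z t' d') →
                Rel Z r → (Expr L → Expr L') → Set (v ⊔ z ⊔ r ⊔ t ⊔ d ⊔ d')
  CorrectUpTo L L' R T =
    (∀ (w : Value L) → Σ (Value L') (λ w' → R (proj₁ w') (proj₁ w)))
    × (∀ (E : Expr L) (η : Valuation L') (ρ : Valuation L) →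
         (R on-valuations η) ρ →
         R (proj₁ (⟦_⟧ L' (T E) η)) (proj₁ (⟦_⟧ L E ρ)))

  IsCongruence : ∀ {t d} (K : Language Var Z t d) → Rel Z r → Set (v ⊔ z ⊔ r ⊔ t ⊔ d)
  IsCongruence K R =
    ∀ (E : Expr K) (ν ρ : Valuation K) →
      (R on-valuations ν) ρ → R (proj₁ (⟦_⟧ K E ν)) (proj₁ (⟦_⟧ K E ρ))

-- Every L-valuation ρ has an L'-valuation η with η ∼ ρ pointwise (correctness (i)).
-- For ν ≈ ρ pick such η_ν and η_ρ; correctness (ii) and ∼ ⊆ ≈ give
-- ⟦E⟧ν ≈ ⟦T E⟧η_ν and ⟦T E⟧η_ρ ≈ ⟦E⟧ρ, while η_ν ≈ η_ρ, so the congruence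
-- property of L' closes the chain ⟦E⟧ν ≈ ⟦T E⟧η_ν ≈ ⟦T E⟧η_ρ ≈ ⟦E⟧ρ.
-- Reflexivity, symmetry and transitivity are needed for ≈ only.
module Submission where

open import Defs
open import Level using (Level)
open import Data.Product using (Σ; _,_; proj₁; proj₂)
open import Relation.Binary.Core using (Rel; _⇒_)
open import Relation.Binary.Structures using (IsEquivalence)

module _ {v z r t d t' d' : Level} {Var : Set v} {Z : Set z}
         (L : Language Var Z t d) (L' : Language Var Z t' d')
         (_∼_ : Rel Z r) {T : Expr L → Expr L'}
         (correct : CorrectUpTo L L' _∼_ T) where

  representative : Valuation L → Valuation L'
  representative ρ X = proj₁ (proj₁ correct (ρ X))

  representative-∼ : ∀ ρ → (_∼_ on-valuations representative ρ) ρ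
  representative-∼ ρ X = proj₂ (proj₁ correct (ρ X))

  ⟦translate-representative⟧-∼ : ∀ E ρ →
    proj₁ (⟦_⟧ L' (T E) (representative ρ)) ∼ proj₁ (⟦_⟧ L E ρ)
  ⟦translate-representative⟧-∼ E ρ =
    proj₂ correct E (representative ρ) ρ (representative-∼ ρ)

  module _ {_≈_ : Rel Z r} (≈-equiv : IsEquivalence _≈_) (∼⊆≈ : _∼_ ⇒ _≈_) where
    open IsEquivalence ≈-equiv

    representative-≈ : ∀ {ν ρ} → (_≈_ on-valuations ν) ρ →
      (_≈_ on-valuations representative ν) (representative ρ)
    representative-≈ {ν} {ρ} ν≈ρ X =
      trans (∼⊆≈ (representative-∼ ν X))
            (trans (ν≈ρ X) (sym (∼⊆≈ (representative-∼ ρ X))))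

    congruence-reflected : IsCongruence L' _≈_ → IsCongruence L _≈_
    congruence-reflected ≈-cong' E ν ρ ν≈ρ =
      trans (sym (∼⊆≈ (⟦translate-representative⟧-∼ E ν)))
            (trans (≈-cong' (T E) (representative ν) (representative ρ)
                            (representative-≈ ν≈ρ))
                   (∼⊆≈ (⟦translate-representative⟧-∼ E ρ)))

corollary1 : ∀ {v z r t d t' d' : Level} {Var : Set v} {Z : Set z}
    (L : Language Var Z t d) (L' : Language Var Z t' d')
    (_∼_ _≈_ : Rel Z r) →
    IsEquivalence _∼_ → IsEquivalence _≈_ →
    Σ (Expr L → Expr L') (λ T → CorrectUpTo L L' _∼_ T) →
    IsCongruence L' _≈_ →
    (∀ {p q} → p ∼ q → p ≈ q) →
    IsCongruence L _≈_
corollary1 L L' _∼_ _≈_ _ ≈-equiv (T , correct) ≈-cong' ∼⊆≈ =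
  congruence-reflected L L' _∼_ correct ≈-equiv ∼⊆≈ ≈-cong'
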